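{- For integers $n,k\ge 0$, let $p_{nk}$ denote the number of arithmetic progressions of size $k$ contained in $[n]=\{1,\ldots,n\}$ (with $[0]=\emptyset$). Then, as formal power series, $$f(z,q)=\sum_{k=0}^\infty\sum_{n=0}^\infty p_{nk}z^nq^k=\frac{1}{(1-z)^2}\left(1-z+zq+\sum_{k=2}^\infty\frac{(zq)^k}{1-z^{k-1}}\right).$$
   Context: An arithmetic progression in $[n]$ is a set of the form $\{a,a+r,\ldots,a+(k-1)r\}\subseteq[n]$ with integers $a$, $r\ge1$, $k\ge0$, considered as a set; the empty set counts as the unique progression of size $0$ (so $p_{n0}=1$ for all $n\ge 0$), and every singleton and every $2$-element subset is a progression. -}

module Defs where

open import Data.Nat as ℕ using (ℕ; zero; suc; _≤_; _<_; _∸_)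
open import Data.Integer as ℤ using (ℤ; +_)
open import Data.Fin using (Fin; toℕ)
open import Data.Fin.Subset using (Subset; _∈_; ∣_∣)
open import Data.Product using (Σ; ∃; _×_; _,_)
open import Relation.Binary.PropositionalEquality using (_≡_)
open import Function.Bundles using (_⇔_)
open import Relation.Nullary using (yes; no)

-- Arithmetic progressions in [n] = {1,…,n}.
-- A subset of [n] is encoded as S : Subset n (= Vec Bool n), where the
-- element x : Fin n stands for the integer toℕ x + 1 ∈ [n].

IsAPWith : ∀ {n} → Subset n → ℕ → ℕ → ℕ → Set
IsAPWith {n} S a r len =
  (1 ≤ r) ×
  ((∀ i → i < len → (1 ≤ a ℕ.+ i ℕ.* r) × (a ℕ.+ i ℕ.* r ≤ n)) ×
   (∀ (x : Fin n) → (x ∈ S) ⇔ (∃ λ i → (i < len) × (toℕ x ℕ.+ 1 ≡ a ℕ.+ i ℕ.* r))))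

IsAP : ∀ {n} → Subset n → Set
IsAP S = ∃ λ a → ∃ λ r → ∃ λ len → IsAPWith S a r len

-- Arithmetic progressions of size k in [n], considered as sets: a subset
-- together with an *irrelevant* proof that it is a progression, so that
-- two elements are equal iff the underlying subsets are equal.
record AP (n k : ℕ) : Set where
  constructor ap
  field
    set   : Subset n
    size  : ∣ set ∣ ≡ k
    .isAP : IsAP set

-- Formal power series in z, q with integer coefficients:
-- F n m is the coefficient of z^n q^m.

PS : Set
PS = ℕ → ℕ → ℤ

sumTo : ℕ → (ℕ → ℤ) → ℤ
sumTo zero    f = f 0
sumTo (suc n) f = sumTo n f ℤ.+ f (suc n)

mono : ℕ → ℕ → PS
mono i j n m with i ℕ.≟ n | j ℕ.≟ m
... | yes _ | yes _ = + 1
... | _ | _ = + 0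

zeroPS onePS zPS qPS : PS
zeroPS _ _ = + 0
onePS = mono 0 0
zPS   = mono 1 0
qPS   = mono 0 1

_⊕_ : PS → PS → PS
(F ⊕ G) n m = F n m ℤ.+ G n m

_⊖_ : PS → PS → PS
(F ⊖ G) n m = F n m ℤ.- G n m

_⊛_ : PS → PS → PS
(F ⊛ G) n m = sumTo n λ a → sumTo m λ b → F a b ℤ.* G (n ∸ a) (m ∸ b)

pow : PS → ℕ → PS
pow F zero    = onePS
pow F (suc k) = F ⊛ pow F k

-- Sum of a family (F k)_k with F k of total order ≥ k (a summable
-- family): only k ≤ n + m contribute to the coefficient of z^n q^m.
sumFam : (ℕ → PS) → PS
sumFam F n m = sumTo (n ℕ.+ m) λ k → F k n m

-- 1/(1-X) = Σ_{i≥0} X^i, for X with zero constant term.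
inv1m : PS → PS
inv1m X = sumFam (pow X)

rhsTerm : ℕ → PS
rhsTerm zero          = zeroPS
rhsTerm (suc zero)    = zeroPS
rhsTerm (suc (suc j)) = pow (zPS ⊛ qPS) (suc (suc j)) ⊛ inv1m (pow zPS (suc j))

RHS : PS
RHS = (inv1m zPS ⊛ inv1m zPS) ⊛ (((onePS ⊖ zPS) ⊕ (zPS ⊛ qPS)) ⊕ sumFam rhsTerm)

{-# OPTIONS --safe #-}
-- Since 1/(1 - z)² = Σ_a (a + 1) zᵃ and (zq)ᵏ/(1 - zᵏ⁻¹) = Σ_{r ≥ 1} qᵏ z^(1 + (k - 1) r), the
-- coefficient of zⁿ qᵏ on the right is 1 for k = 0, n for k = 1, and for k ≥ 2 the sum of a + 1 over
-- those a ≤ n with n - a = 1 + (k - 1) r for some r ≥ 1.  A progression of k ≥ 2 terms has a unique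
-- first term and step r ≥ 1, and occupies a block of 1 + (k - 1) r consecutive integers, which fits
-- into [n] in exactly a + 1 ways.  The empty set and the n singletons are the progressions of size 0 and 1.

module Submission where

open import Defs
open import Data.Bool as Bool using (true; false)
open import Data.Empty using (⊥-elim)
open import Data.Fin as Fin using (Fin; toℕ; fromℕ<)
import Data.Fin.Properties as FinP
open import Data.Fin.Subset using (Subset; _∈_; _∉_; ∣_∣; ⊥; ⁅_⁆; _∪_; Empty)
open import Data.Fin.Subset.Properties
  using (∉⊥; x∈⁅x⁆; x∈⁅y⁆⇒x≡y; x∈⁅y⁆⇔x≡y; ∣⁅x⁆∣≡1; ∪⇔⊎; ⊆-antisym; ∣⊥∣≡0; Empty-unique; ∪-identityʳ)
open import Data.Integer as ℤ using (ℤ; +_)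
import Data.Integer.Properties as ℤP
open import Data.Integer.Tactic.RingSolver using (solve-∀)
open import Data.Nat as ℕ using (ℕ; zero; suc; _≤_; _<_; _∸_; z≤n; s≤s; s≤s⁻¹; _≟_; _≤?_)
import Data.Nat.Properties as ℕP
open import Data.Nat.DivMod using (_/_; m*n/n≡m)
open import Data.Nat.Divisibility using (_∣_; divides; _∣?_; 1∣_)
open import Data.Product using (Σ; ∃; _×_; _,_; proj₁; proj₂)
open import Data.Product.Function.NonDependent.Propositional using (_×-⇔_)
open import Data.Sum using (_⊎_; inj₁; inj₂)
open import Data.Sum.Function.Propositional using (_⊎-⇔_; _⊎-↔_)
open import Data.Vec using (tabulate; here; there; _∷_; [])
import Data.Vec.Properties as VecP
open import Function using (_∘_)
open import Function.Bundles using (_⇔_; mk⇔; Equivalence; _↔_; mk↔ₛ′; mk⤖)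
open import Function.Properties.Bijection using (⤖⇒↔)
open import Function.Properties.Equivalence using () renaming (trans to ⇔-trans; sym to ⇔-sym)
open import Function.Properties.Inverse using (↔-trans; ↔-refl)
open import Relation.Nullary using (¬_; yes; no; Dec; does)
open import Relation.Nullary.Decidable using (_×-dec_; dec-true; map′; recompute)
open import Relation.Binary.PropositionalEquality

sumTo-cong : ∀ N {f g : ℕ → ℤ} → (∀ a → f a ≡ g a) → sumTo N f ≡ sumTo N g
sumTo-cong zero    f≗g = f≗g 0
sumTo-cong (suc N) f≗g = cong₂ ℤ._+_ (sumTo-cong N f≗g) (f≗g (suc N))

sumTo-zero : ∀ N {f : ℕ → ℤ} → (∀ a → a ≤ N → f a ≡ + 0) → sumTo N f ≡ + 0
sumTo-zero zero    f≗0 = f≗0 0 z≤n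
sumTo-zero (suc N) f≗0 =
  cong₂ ℤ._+_ (sumTo-zero N λ a a≤N → f≗0 a (ℕP.m≤n⇒m≤1+n a≤N)) (f≗0 (suc N) ℕP.≤-refl)

sumTo-single : ∀ N i {f : ℕ → ℤ} → i ≤ N → (∀ a → a ≤ N → a ≢ i → f a ≡ + 0) → sumTo N f ≡ f i
sumTo-single zero    .zero z≤n  _    = refl
sumTo-single (suc N) i {f} i≤1+N rest with ℕP.m≤n⇒m<n∨m≡n i≤1+N
... | inj₁ (s≤s i≤N) = begin
  sumTo N f ℤ.+ f (suc N) ≡⟨ cong₂ ℤ._+_ (sumTo-single N i i≤N λ a a≤N → rest a (ℕP.m≤n⇒m≤1+n a≤N))
                                          (rest (suc N) ℕP.≤-refl (ℕP.<⇒≢ (s≤s i≤N) ∘ sym)) ⟩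
  f i ℤ.+ + 0             ≡⟨ ℤP.+-identityʳ (f i) ⟩
  f i                     ∎
  where open ≡-Reasoning
... | inj₂ refl = begin
  sumTo N f ℤ.+ f (suc N)
    ≡⟨ cong (ℤ._+ f (suc N)) (sumTo-zero N λ a a≤N → rest a (ℕP.m≤n⇒m≤1+n a≤N) (ℕP.<⇒≢ (s≤s a≤N))) ⟩
  + 0 ℤ.+ f (suc N)       ≡⟨ ℤP.+-identityˡ (f (suc N)) ⟩
  f (suc N)               ∎
  where open ≡-Reasoning

sumTo-unfoldˡ : ∀ N (f : ℕ → ℤ) → sumTo (suc N) f ≡ f 0 ℤ.+ sumTo N (f ∘ suc)
sumTo-unfoldˡ zero    f = refl
sumTo-unfoldˡ (suc N) f = trans (cong (ℤ._+ f (suc (suc N))) (sumTo-unfoldˡ N f)) (ℤP.+-assoc (f 0) _ _)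

sumTo-const-1 : ∀ N → sumTo N (λ _ → + 1) ≡ + suc N
sumTo-const-1 zero    = refl
sumTo-const-1 (suc N) = trans (cong (ℤ._+ + 1) (sumTo-const-1 N)) (cong +_ (ℕP.+-comm (suc N) 1))

sumTo-distrib-minus : ∀ N (f g : ℕ → ℤ) → sumTo N (λ a → f a ℤ.- g a) ≡ sumTo N f ℤ.- sumTo N g
sumTo-distrib-minus zero    f g = refl
sumTo-distrib-minus (suc N) f g =
  trans (cong (ℤ._+ (f (suc N) ℤ.- g (suc N))) (sumTo-distrib-minus N f g))
        (interchange (sumTo N f) (sumTo N g) (f (suc N)) (g (suc N)))
  where
  interchange : ∀ (x y u v : ℤ) → (x ℤ.- y) ℤ.+ (u ℤ.- v) ≡ (x ℤ.+ u) ℤ.- (y ℤ.+ v)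
  interchange = solve-∀

-- Σ_{a ≤ n} w a with the first term peeled off, matching the decomposition of Fin (suc n)
sumℕ : (ℕ → ℕ) → ℕ → ℕ
sumℕ w zero    = w 0
sumℕ w (suc n) = w 0 ℕ.+ sumℕ (w ∘ suc) n

+sumℕ≡sumTo : ∀ w n → + sumℕ w n ≡ sumTo n (+_ ∘ w)
+sumℕ≡sumTo w zero    = refl
+sumℕ≡sumTo w (suc n) = begin
  + (w 0 ℕ.+ sumℕ (w ∘ suc) n)    ≡⟨ ℤP.pos-+ (w 0) _ ⟩
  + w 0 ℤ.+ + sumℕ (w ∘ suc) n    ≡⟨ cong (λ s → + w 0 ℤ.+ s) (+sumℕ≡sumTo (w ∘ suc) n) ⟩
  + w 0 ℤ.+ sumTo n (+_ ∘ w ∘ suc) ≡⟨ sumTo-unfoldˡ n (+_ ∘ w) ⟨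
  sumTo (suc n) (+_ ∘ w)           ∎
  where open ≡-Reasoning

Fin-sumℕ↔Σ : ∀ w n → Fin (sumℕ w n) ↔ Σ (Fin (suc n)) (Fin ∘ w ∘ toℕ)
Fin-sumℕ↔Σ w zero    = mk↔ₛ′ (Fin.zero ,_) (λ { (Fin.zero , x) → x ; (Fin.suc () , _) })
                                   (λ { (Fin.zero , x) → refl ; (Fin.suc () , _) }) λ _ → refl
Fin-sumℕ↔Σ w (suc n) = ↔-trans FinP.+↔⊎ (↔-trans (↔-refl ⊎-↔ Fin-sumℕ↔Σ (w ∘ suc) n) peel)
  where
  peel : (Fin (w 0) ⊎ Σ (Fin (suc n)) (Fin ∘ w ∘ suc ∘ toℕ)) ↔ Σ (Fin (suc (suc n))) (Fin ∘ w ∘ toℕ)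
  peel = mk↔ₛ′ (λ { (inj₁ x) → Fin.zero , x ; (inj₂ (a , x)) → Fin.suc a , x })
               (λ { (Fin.zero , x) → inj₁ x ; (Fin.suc a , x) → inj₂ (a , x) })
               (λ { (Fin.zero , x) → refl ; (Fin.suc a , x) → refl })
               (λ { (inj₁ x) → refl ; (inj₂ (a , x)) → refl })

mono-on : ∀ {i j n m} → i ≡ n × j ≡ m → mono i j n m ≡ + 1
mono-on {i} {j} {n} {m} (i≡n , j≡m) with i ≟ n | j ≟ m
... | yes _   | yes _   = refl
... | no i≢n  | _       = ⊥-elim (i≢n i≡n)
... | yes _   | no j≢m  = ⊥-elim (j≢m j≡m)

mono-off : ∀ {i j n m} → ¬ (i ≡ n × j ≡ m) → mono i j n m ≡ + 0
mono-off {i} {j} {n} {m} ¬eq with i ≟ n | j ≟ m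
... | yes i≡n | yes j≡m = ⊥-elim (¬eq (i≡n , j≡m))
... | yes _   | no _    = refl
... | no _    | _       = refl

mono-q≢ : ∀ i j n {m} → j ≢ m → mono i j n m ≡ + 0
mono-q≢ i j n j≢m = mono-off (j≢m ∘ proj₂)

mono-cong-⇔ : ∀ {i j n m i′ j′ n′ m′} → ((i ≡ n × j ≡ m) ⇔ (i′ ≡ n′ × j′ ≡ m′)) →
              mono i j n m ≡ mono i′ j′ n′ m′
mono-cong-⇔ {i} {j} {n} {m} eq⇔eq′ with (i ≟ n) ×-dec (j ≟ m)
... | yes eq  = trans (mono-on eq) (sym (mono-on (Equivalence.to eq⇔eq′ eq)))
... | no ¬eq = trans (mono-off ¬eq) (sym (mono-off (¬eq ∘ Equivalence.from eq⇔eq′)))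

infix 4 _≗₂_
_≗₂_ : PS → PS → Set
F ≗₂ G = ∀ n m → F n m ≡ G n m

⊛-congˡ : ∀ {F F′} (G : PS) → F ≗₂ F′ → F ⊛ G ≗₂ F′ ⊛ G
⊛-congˡ G F≗F′ n m = sumTo-cong n λ a → sumTo-cong m λ b → cong (ℤ._* _) (F≗F′ a b)

⊛-congʳ : ∀ (F : PS) {G G′} → G ≗₂ G′ → F ⊛ G ≗₂ F ⊛ G′
⊛-congʳ F G≗G′ n m = sumTo-cong n λ a → sumTo-cong m λ b → cong (F a b ℤ.*_) (G≗G′ _ _)

pow-cong : ∀ {F F′} → F ≗₂ F′ → ∀ t → pow F t ≗₂ pow F′ t
pow-cong F≗F′ zero              n m = refl
pow-cong {F} {F′} F≗F′ (suc t) n m =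
  trans (⊛-congˡ (pow F t) F≗F′ n m) (⊛-congʳ F′ (pow-cong F≗F′ t) n m)

inv1m-cong : ∀ {X Y} → X ≗₂ Y → inv1m X ≗₂ inv1m Y
inv1m-cong X≗Y n m = sumTo-cong (n ℕ.+ m) λ t → pow-cong X≗Y t n m

coeff-mono⊛ : ∀ i j (G : PS) {n m} → i ≤ n → j ≤ m → (mono i j ⊛ G) n m ≡ G (n ∸ i) (m ∸ j)
coeff-mono⊛ i j G {n} {m} i≤n j≤m = begin
  (mono i j ⊛ G) n m
    ≡⟨ sumTo-single n i i≤n (λ a _ a≢i → sumTo-zero m λ b _ → term-off (a≢i ∘ sym ∘ proj₁)) ⟩
  sumTo m (λ b → mono i j i b ℤ.* G (n ∸ i) (m ∸ b))
    ≡⟨ sumTo-single m j j≤m (λ b _ b≢j → term-off (b≢j ∘ sym ∘ proj₂)) ⟩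
  mono i j i j ℤ.* G (n ∸ i) (m ∸ j)
    ≡⟨ cong (ℤ._* G (n ∸ i) (m ∸ j)) (mono-on {i} {j} {i} {j} (refl , refl)) ⟩
  + 1 ℤ.* G (n ∸ i) (m ∸ j)
    ≡⟨ ℤP.*-identityˡ _ ⟩
  G (n ∸ i) (m ∸ j) ∎
  where
  open ≡-Reasoning
  term-off : ∀ {a b x} → ¬ (i ≡ a × j ≡ b) → mono i j a b ℤ.* x ≡ + 0
  term-off {x = x} ne = trans (cong (ℤ._* x) (mono-off ne)) (ℤP.*-zeroˡ x)

coeff-mono⊛-≰ : ∀ i j (G : PS) {n m} → ¬ (i ≤ n × j ≤ m) → (mono i j ⊛ G) n m ≡ + 0
coeff-mono⊛-≰ i j G {n} {m} ¬le = sumTo-zero n λ a a≤n → sumTo-zero m λ b b≤m →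
  trans (cong (ℤ._* G (n ∸ a) (m ∸ b)) (mono-off λ (i≡a , j≡b) →
           ¬le (subst (_≤ n) (sym i≡a) a≤n , subst (_≤ m) (sym j≡b) b≤m)))
        (ℤP.*-zeroˡ (G (n ∸ a) (m ∸ b)))

≡∸⇔+≡ : ∀ {i n a} → i ≤ n → (a ≡ n ∸ i) ⇔ (i ℕ.+ a ≡ n)
≡∸⇔+≡ {i} {n} {a} i≤n = mk⇔ (λ { refl → ℕP.m+[n∸m]≡n i≤n }) (λ { refl → sym (ℕP.m+n∸m≡n i a) })

mono⊛mono : ∀ i j a b → mono i j ⊛ mono a b ≗₂ mono (i ℕ.+ a) (j ℕ.+ b)
mono⊛mono i j a b n m with (i ≤? n) ×-dec (j ≤? m)
... | yes (i≤n , j≤m) = trans (coeff-mono⊛ i j (mono a b) i≤n j≤m) (mono-cong-⇔ (≡∸⇔+≡ i≤n ×-⇔ ≡∸⇔+≡ j≤m))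
... | no ¬le = trans (coeff-mono⊛-≰ i j (mono a b) ¬le) (sym (mono-off λ (i+a≡n , j+b≡m) →
  ¬le (subst (i ≤_) i+a≡n (ℕP.m≤m+n i a) , subst (j ≤_) j+b≡m (ℕP.m≤m+n j b))))

pow-mono : ∀ i j t → pow (mono i j) t ≗₂ mono (t ℕ.* i) (t ℕ.* j)
pow-mono i j zero    n m = refl
pow-mono i j (suc t) n m = trans (⊛-congʳ (mono i j) (pow-mono i j t) n m) (mono⊛mono i j _ _ n m)

inv1m-mono : ∀ d n m → inv1m (mono (suc d) 0) n m ≡ sumTo (n ℕ.+ m) λ t → mono (t ℕ.* suc d) 0 n m
inv1m-mono d n m = sumTo-cong (n ℕ.+ m) λ t →
  trans (pow-mono (suc d) 0 t n m) (cong (λ z → mono (t ℕ.* suc d) z n m) (ℕP.*-zeroʳ t))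

inv1m-mono-∣ : ∀ d n → suc d ∣ n → inv1m (mono (suc d) 0) n 0 ≡ + 1
inv1m-mono-∣ d n (divides q n≡q*d) = begin
  inv1m (mono (suc d) 0) n 0                   ≡⟨ inv1m-mono d n 0 ⟩
  sumTo (n ℕ.+ 0) (λ t → mono (t ℕ.* suc d) 0 n 0) ≡⟨ sumTo-single (n ℕ.+ 0) q q≤n+0 off ⟩
  mono (q ℕ.* suc d) 0 n 0                     ≡⟨ mono-on (sym n≡q*d , refl) ⟩
  + 1                                          ∎
  where
  open ≡-Reasoning
  q≤n+0 : q ≤ n ℕ.+ 0
  q≤n+0 = ℕP.≤-trans (subst (q ≤_) (sym n≡q*d) (ℕP.m≤m*n q (suc d))) (ℕP.m≤m+n n 0)
  off : ∀ t → t ≤ n ℕ.+ 0 → t ≢ q → mono (t ℕ.* suc d) 0 n 0 ≡ + 0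
  off t _ t≢q = mono-off λ (t*d≡n , _) → t≢q (ℕP.*-cancelʳ-≡ t q (suc d) (trans t*d≡n n≡q*d))

inv1m-mono-∤ : ∀ d n m → ¬ (suc d ∣ n × m ≡ 0) → inv1m (mono (suc d) 0) n m ≡ + 0
inv1m-mono-∤ d n m ¬∣ = trans (inv1m-mono d n m) (sumTo-zero (n ℕ.+ m) λ t _ →
  mono-off λ (t*d≡n , 0≡m) → ¬∣ (divides t (sym t*d≡n) , sym 0≡m))

-- m = 1 + (j + 1) r for some r ≥ 1, i.e. m integers are spanned by a (j + 2)-term progression of step r
Span : ℕ → ℕ → Set
Span j m = suc (suc j) ≤ m × suc j ∣ m ∸ suc (suc j)

span? : ∀ j m → Dec (Span j m)
span? j m = (suc (suc j) ≤? m) ×-dec (suc j ∣? (m ∸ suc (suc j)))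

step : ℕ → ℕ → ℕ
step j m = suc ((m ∸ suc (suc j)) / suc j)

step-divides : ∀ j m {q} → m ∸ suc (suc j) ≡ q ℕ.* suc j → step j m ≡ suc q
step-divides j m {q} m∸k≡q*d = cong suc (trans (cong (_/ suc j) m∸k≡q*d) (m*n/n≡m q (suc j)))

Span⇒≡ : ∀ j {m} → Span j m → m ≡ suc (suc j ℕ.* step j m)
Span⇒≡ j {m} (k≤m , divides q m∸k≡q*d) = begin
  m                                  ≡⟨ ℕP.m+[n∸m]≡n k≤m ⟨
  suc (suc j) ℕ.+ (m ∸ suc (suc j))  ≡⟨ cong (suc (suc j) ℕ.+_) m∸k≡q*d ⟩
  suc (suc j) ℕ.+ q ℕ.* suc j        ≡⟨ cong (λ z → suc (suc j ℕ.+ z)) (ℕP.*-comm q (suc j)) ⟩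
  suc (suc j ℕ.+ suc j ℕ.* q)        ≡⟨ cong suc (ℕP.*-suc (suc j) q) ⟨
  suc (suc j ℕ.* suc q)              ≡⟨ cong (λ r → suc (suc j ℕ.* r)) (step-divides j m m∸k≡q*d) ⟨
  suc (suc j ℕ.* step j m)           ∎
  where open ≡-Reasoning

Span-of-step : ∀ j r → Span j (suc (suc j ℕ.* suc r)) × step j (suc (suc j ℕ.* suc r)) ≡ suc r
Span-of-step j r =
  (s≤s (ℕP.m≤m*n (suc j) (suc r)) , divides r m∸k≡r*d) , step-divides j (suc (suc j ℕ.* suc r)) m∸k≡r*d
  where
  m∸k≡r*d : suc (suc j ℕ.* suc r) ∸ suc (suc j) ≡ r ℕ.* suc j
  m∸k≡r*d = trans (cong (_∸ suc j) (ℕP.*-suc (suc j) r))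
                  (trans (ℕP.m+n∸m≡n (suc j) (suc j ℕ.* r)) (ℕP.*-comm (suc j) r))

step-injective : ∀ j {m m′} → Span j m → Span j m′ → step j m ≡ step j m′ → m ≡ m′
step-injective j span span′ r≡r′ =
  trans (Span⇒≡ j span) (trans (cong (λ r → suc (suc j ℕ.* r)) r≡r′) (sym (Span⇒≡ j span′)))

positions : ∀ {A : Set} → Dec A → ℕ → ℕ
positions (yes _) a = suc a
positions (no _)  _ = 0

positions-fromℕ : ∀ {A : Set} (a? : Dec A) → A → ∀ {a v} → v ≤ a → Σ (Fin (positions a? a)) λ x → toℕ x ≡ v
positions-fromℕ (yes _) _ v≤a = fromℕ< (s≤s v≤a) , FinP.toℕ-fromℕ< (s≤s v≤a)
positions-fromℕ (no ¬A) A _   = ⊥-elim (¬A A)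

positions-toℕ : ∀ {A : Set} (a? : Dec A) {a} (x : Fin (positions a? a)) → A × toℕ x ≤ a
positions-toℕ (yes A) x = A , s≤s⁻¹ (FinP.toℕ<n x)

count : ℕ → ℕ → ℕ
count j n = sumℕ (λ a → positions (span? j (n ∸ a)) a) n

-- Coefficients of the right-hand side

-- Coefficient of zⁿ in f / (1 - z)², for f given by its coefficients
ramp : (ℕ → ℤ) → ℕ → ℤ
ramp f n = sumTo n λ a → + suc a ℤ.* f (n ∸ a)

ramp-cong : ∀ {f g : ℕ → ℤ} n → (∀ m → f m ≡ g m) → ramp f n ≡ ramp g n
ramp-cong n f≗g = sumTo-cong n λ a → cong (+ suc a ℤ.*_) (f≗g (n ∸ a))

ramp-distrib-minus : ∀ (f g : ℕ → ℤ) n → ramp (λ m → f m ℤ.- g m) n ≡ ramp f n ℤ.- ramp g n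
ramp-distrib-minus f g n =
  trans (sumTo-cong n λ a → *-distribˡ-minus (+ suc a) (f (n ∸ a)) (g (n ∸ a))) (sumTo-distrib-minus n _ _)
  where
  *-distribˡ-minus : ∀ (x y z : ℤ) → x ℤ.* (y ℤ.- z) ≡ x ℤ.* y ℤ.- x ℤ.* z
  *-distribˡ-minus = solve-∀

ramp-mono : ∀ e j n → ramp (λ m → mono e j m j) n ≡ + (suc n ∸ e)
ramp-mono e j n with e ≤? n
... | yes e≤n = begin
  ramp (λ m → mono e j m j) n                    ≡⟨ sumTo-single n (n ∸ e) (ℕP.m∸n≤m n e) off ⟩
  + suc (n ∸ e) ℤ.* mono e j (n ∸ (n ∸ e)) j
    ≡⟨ cong (+ suc (n ∸ e) ℤ.*_) (mono-on (sym (ℕP.m∸[m∸n]≡n e≤n) , refl)) ⟩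
  + suc (n ∸ e) ℤ.* + 1                          ≡⟨ ℤP.*-identityʳ _ ⟩
  + suc (n ∸ e)                                  ≡⟨ cong +_ (ℕP.+-∸-assoc 1 e≤n) ⟨
  + (suc n ∸ e)                                  ∎
  where
  open ≡-Reasoning
  off : ∀ a → a ≤ n → a ≢ n ∸ e → + suc a ℤ.* mono e j (n ∸ a) j ≡ + 0
  off a a≤n a≢ = trans (cong (+ suc a ℤ.*_) (mono-off λ (e≡ , _) →
                   a≢ (trans (sym (ℕP.m∸[m∸n]≡n a≤n)) (cong (n ∸_) (sym e≡)))))
                 (ℤP.*-zeroʳ (+ suc a))
... | no e≰n = trans (sumTo-zero n off) (cong +_ (sym (ℕP.m≤n⇒m∸n≡0 (ℕP.≰⇒> e≰n))))
  where
  off : ∀ a → a ≤ n → + suc a ℤ.* mono e j (n ∸ a) j ≡ + 0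
  off a _ = trans (cong (+ suc a ℤ.*_) (mono-off λ (e≡ , _) → e≰n (subst (_≤ n) (sym e≡) (ℕP.m∸n≤m n a))))
                  (ℤP.*-zeroʳ (+ suc a))

inv1m-z² : PS
inv1m-z² = inv1m zPS ⊛ inv1m zPS

numerator : PS
numerator = ((onePS ⊖ zPS) ⊕ (zPS ⊛ qPS)) ⊕ sumFam rhsTerm

inv1m-z-0 : ∀ n → inv1m zPS n 0 ≡ + 1
inv1m-z-0 n = inv1m-mono-∣ 0 n (1∣ n)

inv1m-z-≢0 : ∀ n {m} → m ≢ 0 → inv1m zPS n m ≡ + 0
inv1m-z-≢0 n {m} m≢0 = inv1m-mono-∤ 0 n m (m≢0 ∘ proj₂)

inv1m-z²-0 : ∀ n → inv1m-z² n 0 ≡ + suc n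
inv1m-z²-0 n = trans (sumTo-cong n λ a → cong₂ ℤ._*_ (inv1m-z-0 a) (inv1m-z-0 (n ∸ a))) (sumTo-const-1 n)

inv1m-z²-≢0 : ∀ n {m} → m ≢ 0 → inv1m-z² n m ≡ + 0
inv1m-z²-≢0 n {m} m≢0 = sumTo-zero n λ a _ → sumTo-zero m λ where
  zero    _ → trans (cong (inv1m zPS a 0 ℤ.*_) (inv1m-z-≢0 (n ∸ a) m≢0)) (ℤP.*-zeroʳ (inv1m zPS a 0))
  (suc b) _ → trans (cong (ℤ._* inv1m zPS (n ∸ a) (m ∸ suc b)) (inv1m-z-≢0 a λ ()))
                    (ℤP.*-zeroˡ (inv1m zPS (n ∸ a) (m ∸ suc b)))

RHS≡ramp : ∀ n k → RHS n k ≡ ramp (λ m → numerator m k) n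
RHS≡ramp n k = sumTo-cong n λ a → begin
  sumTo k (λ b → inv1m-z² a b ℤ.* numerator (n ∸ a) (k ∸ b))
    ≡⟨ sumTo-single k 0 z≤n (λ b _ b≢0 → trans (cong (ℤ._* numerator (n ∸ a) (k ∸ b)) (inv1m-z²-≢0 a b≢0))
                                                (ℤP.*-zeroˡ (numerator (n ∸ a) (k ∸ b)))) ⟩
  inv1m-z² a 0 ℤ.* numerator (n ∸ a) k
    ≡⟨ cong (ℤ._* numerator (n ∸ a) k) (inv1m-z²-0 a) ⟩
  + suc a ℤ.* numerator (n ∸ a) k ∎
  where open ≡-Reasoning

rhsTerm-shape : ∀ j → rhsTerm (suc (suc j)) ≗₂ mono (suc (suc j)) (suc (suc j)) ⊛ inv1m (mono (suc j) 0)
rhsTerm-shape j n m =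
  trans (⊛-congˡ (inv1m (pow zPS (suc j))) [zq]ᵏ n m) (⊛-congʳ (mono k k) (inv1m-cong zᵈ) n m)
  where
  k = suc (suc j)
  [zq]ᵏ : pow (zPS ⊛ qPS) k ≗₂ mono k k
  [zq]ᵏ a b = begin
    pow (zPS ⊛ qPS) k a b       ≡⟨ pow-cong (mono⊛mono 1 0 0 1) k a b ⟩
    pow (mono 1 1) k a b         ≡⟨ pow-mono 1 1 k a b ⟩
    mono (k ℕ.* 1) (k ℕ.* 1) a b ≡⟨ cong₂ (λ x y → mono x y a b) (ℕP.*-identityʳ k) (ℕP.*-identityʳ k) ⟩
    mono k k a b                 ∎
    where open ≡-Reasoning
  zᵈ : pow zPS (suc j) ≗₂ mono (suc j) 0
  zᵈ a b = trans (pow-mono 1 0 (suc j) a b)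
                 (cong₂ (λ x y → mono x y a b) (ℕP.*-identityʳ (suc j)) (ℕP.*-zeroʳ (suc j)))

rhsTerm-homogeneous : ∀ t {n m} → t ≢ m → rhsTerm t n m ≡ + 0
rhsTerm-homogeneous zero                _   = refl
rhsTerm-homogeneous (suc zero)          _   = refl
rhsTerm-homogeneous (suc (suc j)) {n} {m} t≢m with (suc (suc j) ≤? n) ×-dec (suc (suc j) ≤? m)
... | yes (k≤n , k≤m) = begin
  rhsTerm (suc (suc j)) n m                          ≡⟨ rhsTerm-shape j n m ⟩
  (mono k k ⊛ G) n m                                 ≡⟨ coeff-mono⊛ k k G k≤n k≤m ⟩
  G (n ∸ k) (m ∸ k)                                  ≡⟨ inv1m-mono-∤ j (n ∸ k) (m ∸ k) m∸k≢0 ⟩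
  + 0                                                ∎
  where
  open ≡-Reasoning
  k = suc (suc j)
  G = inv1m (mono (suc j) 0)
  m∸k≢0 : ¬ (suc j ∣ n ∸ k × m ∸ k ≡ 0)
  m∸k≢0 (_ , m∸k≡0) = t≢m (ℕP.≤-antisym k≤m (ℕP.m∸n≡0⇒m≤n m∸k≡0))
... | no ¬le = trans (rhsTerm-shape j n m) (coeff-mono⊛-≰ k k (inv1m (mono (suc j) 0)) ¬le)
  where k = suc (suc j)

sumFam-rhsTerm : ∀ n m → sumFam rhsTerm n m ≡ rhsTerm m n m
sumFam-rhsTerm n m = sumTo-single (n ℕ.+ m) m (ℕP.m≤n+m m n) λ t _ t≢m → rhsTerm-homogeneous t t≢m

numerator-coeff : ∀ m k → numerator m k ≡ ((mono 0 0 m k ℤ.- mono 1 0 m k) ℤ.+ mono 1 1 m k) ℤ.+ rhsTerm k m k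
numerator-coeff m k =
  cong₂ ℤ._+_ (cong (λ s → (mono 0 0 m k ℤ.- mono 1 0 m k) ℤ.+ s) (mono⊛mono 1 0 0 1 m k)) (sumFam-rhsTerm m k)

numerator-0 : ∀ m → numerator m 0 ≡ mono 0 0 m 0 ℤ.- mono 1 0 m 0
numerator-0 m = begin
  numerator m 0                                               ≡⟨ numerator-coeff m 0 ⟩
  ((mono 0 0 m 0 ℤ.- mono 1 0 m 0) ℤ.+ mono 1 1 m 0) ℤ.+ + 0   ≡⟨ ℤP.+-identityʳ _ ⟩
  (mono 0 0 m 0 ℤ.- mono 1 0 m 0) ℤ.+ mono 1 1 m 0
    ≡⟨ cong (λ x → (mono 0 0 m 0 ℤ.- mono 1 0 m 0) ℤ.+ x) (mono-q≢ 1 1 m λ ()) ⟩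
  (mono 0 0 m 0 ℤ.- mono 1 0 m 0) ℤ.+ + 0                     ≡⟨ ℤP.+-identityʳ _ ⟩
  mono 0 0 m 0 ℤ.- mono 1 0 m 0                               ∎
  where open ≡-Reasoning

numerator-1 : ∀ m → numerator m 1 ≡ mono 1 1 m 1
numerator-1 m = begin
  numerator m 1                                               ≡⟨ numerator-coeff m 1 ⟩
  ((mono 0 0 m 1 ℤ.- mono 1 0 m 1) ℤ.+ mono 1 1 m 1) ℤ.+ + 0   ≡⟨ ℤP.+-identityʳ _ ⟩
  (mono 0 0 m 1 ℤ.- mono 1 0 m 1) ℤ.+ mono 1 1 m 1
    ≡⟨ cong₂ (λ x y → (x ℤ.- y) ℤ.+ mono 1 1 m 1) (mono-q≢ 0 0 m λ ()) (mono-q≢ 1 0 m λ ()) ⟩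
  + 0 ℤ.+ mono 1 1 m 1                                        ≡⟨ ℤP.+-identityˡ _ ⟩
  mono 1 1 m 1                                                ∎
  where open ≡-Reasoning

numerator-2+ : ∀ j m → numerator m (suc (suc j)) ≡ rhsTerm (suc (suc j)) m (suc (suc j))
numerator-2+ j m = begin
  numerator m k                                                          ≡⟨ numerator-coeff m k ⟩
  ((mono 0 0 m k ℤ.- mono 1 0 m k) ℤ.+ mono 1 1 m k) ℤ.+ rhsTerm k m k
    ≡⟨ cong₂ (λ x y → (x ℤ.- y) ℤ.+ mono 1 1 m k ℤ.+ rhsTerm k m k) (mono-q≢ 0 0 m λ ()) (mono-q≢ 1 0 m λ ()) ⟩
  (+ 0 ℤ.+ mono 1 1 m k) ℤ.+ rhsTerm k m k
    ≡⟨ cong (λ x → (+ 0 ℤ.+ x) ℤ.+ rhsTerm k m k) (mono-q≢ 1 1 m λ ()) ⟩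
  + 0 ℤ.+ rhsTerm k m k                                                  ≡⟨ ℤP.+-identityˡ _ ⟩
  rhsTerm k m k                                                          ∎
  where
  open ≡-Reasoning
  k = suc (suc j)

rhsTerm-diag-yes : ∀ j {m} → Span j m → rhsTerm (suc (suc j)) m (suc (suc j)) ≡ + 1
rhsTerm-diag-yes j {m} (k≤m , d∣m∸k) = begin
  rhsTerm k m k                          ≡⟨ rhsTerm-shape j m k ⟩
  (mono k k ⊛ inv1m (mono d 0)) m k      ≡⟨ coeff-mono⊛ k k (inv1m (mono d 0)) k≤m ℕP.≤-refl ⟩
  inv1m (mono d 0) (m ∸ k) (k ∸ k)       ≡⟨ cong (inv1m (mono d 0) (m ∸ k)) (ℕP.n∸n≡0 k) ⟩
  inv1m (mono d 0) (m ∸ k) 0             ≡⟨ inv1m-mono-∣ j (m ∸ k) d∣m∸k ⟩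
  + 1                                    ∎
  where
  open ≡-Reasoning
  d = suc j
  k = suc d

rhsTerm-diag-no : ∀ j {m} → ¬ Span j m → rhsTerm (suc (suc j)) m (suc (suc j)) ≡ + 0
rhsTerm-diag-no j {m} ¬span with suc (suc j) ≤? m
... | yes k≤m = begin
  rhsTerm k m k                          ≡⟨ rhsTerm-shape j m k ⟩
  (mono k k ⊛ inv1m (mono d 0)) m k      ≡⟨ coeff-mono⊛ k k (inv1m (mono d 0)) k≤m ℕP.≤-refl ⟩
  inv1m (mono d 0) (m ∸ k) (k ∸ k)       ≡⟨ inv1m-mono-∤ j (m ∸ k) (k ∸ k) (λ (d∣ , _) → ¬span (k≤m , d∣)) ⟩
  + 0                                    ∎
  where
  open ≡-Reasoning
  d = suc j
  k = suc d
... | no k≰m = trans (rhsTerm-shape j m (suc (suc j)))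
                     (coeff-mono⊛-≰ k k (inv1m (mono (suc j) 0)) {m} {k} (k≰m ∘ proj₁))
  where k = suc (suc j)

RHS-0 : ∀ n → RHS n 0 ≡ + 1
RHS-0 n = begin
  RHS n 0                                                      ≡⟨ RHS≡ramp n 0 ⟩
  ramp (λ m → numerator m 0) n                                 ≡⟨ ramp-cong n numerator-0 ⟩
  ramp (λ m → mono 0 0 m 0 ℤ.- mono 1 0 m 0) n
    ≡⟨ ramp-distrib-minus (λ m → mono 0 0 m 0) (λ m → mono 1 0 m 0) n ⟩
  ramp (λ m → mono 0 0 m 0) n ℤ.- ramp (λ m → mono 1 0 m 0) n
    ≡⟨ cong₂ ℤ._-_ (ramp-mono 0 0 n) (ramp-mono 1 0 n) ⟩
  + suc n ℤ.- + n                                              ≡⟨ ℤP.[+m]-[+n]≡m⊖n (suc n) n ⟩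
  suc n ℤ.⊖ n                                                  ≡⟨ ℤP.⊖-≥ (ℕP.n≤1+n n) ⟩
  + (suc n ∸ n)                                                ≡⟨ cong +_ (ℕP.m+n∸n≡m 1 n) ⟩
  + 1                                                          ∎
  where open ≡-Reasoning

RHS-1 : ∀ n → RHS n 1 ≡ + n
RHS-1 n = trans (RHS≡ramp n 1) (trans (ramp-cong n numerator-1) (ramp-mono 1 1 n))

RHS-2+ : ∀ j n → RHS n (suc (suc j)) ≡ + count j n
RHS-2+ j n = begin
  RHS n k                                          ≡⟨ RHS≡ramp n k ⟩
  ramp (λ m → numerator m k) n                     ≡⟨ sumTo-cong n (λ a → term a (span? j (n ∸ a))) ⟩
  sumTo n (λ a → + positions (span? j (n ∸ a)) a)  ≡⟨ +sumℕ≡sumTo _ n ⟨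
  + count j n                                      ∎
  where
  open ≡-Reasoning
  k = suc (suc j)
  term : ∀ a (s? : Dec (Span j (n ∸ a))) → + suc a ℤ.* numerator (n ∸ a) k ≡ + positions s? a
  term a (yes s) = trans (cong (+ suc a ℤ.*_) (trans (numerator-2+ j (n ∸ a)) (rhsTerm-diag-yes j s)))
                         (ℤP.*-identityʳ (+ suc a))
  term a (no ¬s) = trans (cong (+ suc a ℤ.*_) (trans (numerator-2+ j (n ∸ a)) (rhsTerm-diag-no j ¬s)))
                         (ℤP.*-zeroʳ (+ suc a))

∈-ext : ∀ {n} {p q : Subset n} → (∀ x → x ∈ p ⇔ x ∈ q) → p ≡ q
∈-ext p⇔q = ⊆-antisym (Equivalence.to (p⇔q _)) (Equivalence.from (p⇔q _))

Empty⇒∣p∣≡0 : ∀ {n} {p : Subset n} → Empty p → ∣ p ∣ ≡ 0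
Empty⇒∣p∣≡0 {n} empty = trans (cong ∣_∣ (Empty-unique empty)) (∣⊥∣≡0 n)

∣p∣≡0⇒p≡⊥ : ∀ {n} (p : Subset n) → ∣ p ∣ ≡ 0 → p ≡ ⊥
∣p∣≡0⇒p≡⊥ []            _       = refl
∣p∣≡0⇒p≡⊥ (false ∷ p) ∣p∣≡0 = cong (false ∷_) (∣p∣≡0⇒p≡⊥ p ∣p∣≡0)
∣p∣≡0⇒p≡⊥ (true  ∷ p) ()

∣p∣≡1⇒p≡⁅x⁆ : ∀ {n} (p : Subset n) → ∣ p ∣ ≡ 1 → ∃ λ x → p ≡ ⁅ x ⁆
∣p∣≡1⇒p≡⁅x⁆ (true  ∷ p) ∣p∣≡1 = Fin.zero , cong (true ∷_) (∣p∣≡0⇒p≡⊥ p (ℕP.suc-injective ∣p∣≡1))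
∣p∣≡1⇒p≡⁅x⁆ (false ∷ p) ∣p∣≡1 with ∣p∣≡1⇒p≡⁅x⁆ p ∣p∣≡1
... | x , p≡⁅x⁆ = Fin.suc x , cong (false ∷_) p≡⁅x⁆

x∉p⇒∣p∪⁅x⁆∣≡1+∣p∣ : ∀ {n} (p : Subset n) (x : Fin n) → x ∉ p → ∣ p ∪ ⁅ x ⁆ ∣ ≡ suc ∣ p ∣
x∉p⇒∣p∪⁅x⁆∣≡1+∣p∣ (false ∷ p) Fin.zero    _   = cong (suc ∘ ∣_∣) (∪-identityʳ p)
x∉p⇒∣p∪⁅x⁆∣≡1+∣p∣ (true  ∷ p) Fin.zero    x∉p = ⊥-elim (x∉p here)
x∉p⇒∣p∪⁅x⁆∣≡1+∣p∣ (false ∷ p) (Fin.suc x) x∉p = x∉p⇒∣p∪⁅x⁆∣≡1+∣p∣ p x (x∉p ∘ there)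
x∉p⇒∣p∪⁅x⁆∣≡1+∣p∣ (true  ∷ p) (Fin.suc x) x∉p = cong suc (x∉p⇒∣p∪⁅x⁆∣≡1+∣p∣ p x (x∉p ∘ there))

select : ∀ {n} {P : Fin n → Set} → (∀ x → Dec (P x)) → Subset n
select P? = tabulate (does ∘ P?)

∈-select : ∀ {n} {P : Fin n → Set} (P? : ∀ x → Dec (P x)) x → x ∈ select P? ⇔ P x
∈-select P? x = mk⇔
  (λ x∈ → does-true (P? x) (trans (sym (VecP.lookup∘tabulate _ x)) (VecP.[]=⇒lookup x∈)))
  (λ Px → VecP.lookup⇒[]= x _ (trans (VecP.lookup∘tabulate _ x) (dec-true (P? x) Px)))
  where
  does-true : ∀ {A : Set} (a? : Dec A) → does a? ≡ true → A
  does-true (yes a) _  = a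
  does-true (no _)  ()

-- Progressions as subsets

∃<suc⇔ : ∀ {P : ℕ → Set} len → (∃ λ i → i < suc len × P i) ⇔ ((∃ λ i → i < len × P i) ⊎ P len)
∃<suc⇔ {P} len = mk⇔ split join
  where
  split : (∃ λ i → i < suc len × P i) → (∃ λ i → i < len × P i) ⊎ P len
  split (i , s≤s i≤len , Pi) with ℕP.m≤n⇒m<n∨m≡n i≤len
  ... | inj₁ i<len = inj₁ (i , i<len , Pi)
  ... | inj₂ refl  = inj₂ Pi
  join : (∃ λ i → i < len × P i) ⊎ P len → ∃ λ i → i < suc len × P i
  join (inj₁ (i , i<len , Pi)) = i , ℕP.m<n⇒m<1+n i<len , Pi
  join (inj₂ Plen)             = len , ℕP.≤-refl , Plen

progression : ∀ n (a r len : ℕ) → Subset n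
progression n a r len = select λ x → ℕP.anyUpTo? (λ i → toℕ x ℕ.+ 1 ≟ a ℕ.+ i ℕ.* r) len

∈-progression : ∀ {n} a r len (x : Fin n) →
                x ∈ progression n a r len ⇔ (∃ λ i → i < len × toℕ x ℕ.+ 1 ≡ a ℕ.+ i ℕ.* r)
∈-progression a r len x = ∈-select (λ x → ℕP.anyUpTo? (λ i → toℕ x ℕ.+ 1 ≟ a ℕ.+ i ℕ.* r) len) x

InRange : ℕ → ℕ → ℕ → ℕ → Set
InRange n a r len = ∀ i → i < len → (1 ≤ a ℕ.+ i ℕ.* r) × (a ℕ.+ i ℕ.* r ≤ n)

InRange-≤ : ∀ {n a r len} → 1 ≤ a → a ℕ.+ len ℕ.* r ≤ n → InRange n a r (suc len)
InRange-≤ {a = a} {r} {len} 1≤a last≤n i (s≤s i≤len) =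
  ℕP.≤-trans 1≤a (ℕP.m≤m+n a (i ℕ.* r)) ,
  ℕP.≤-trans (ℕP.+-monoʳ-≤ a (ℕP.*-monoˡ-≤ r i≤len)) last≤n

IsAPWith⇒≡progression : ∀ {n} {S : Subset n} {a r len} → IsAPWith S a r len → S ≡ progression n a r len
IsAPWith⇒≡progression {a = a} {r} {len} (_ , _ , mem) =
  ∈-ext λ x → ⇔-trans (mem x) (⇔-sym (∈-progression a r len x))

toℕ+1-onto : ∀ {n} v → 1 ≤ v → v ≤ n → ∃ λ (y : Fin n) → toℕ y ℕ.+ 1 ≡ v
toℕ+1-onto (suc v) _ v<n = fromℕ< v<n , trans (cong (ℕ._+ 1) (FinP.toℕ-fromℕ< v<n)) (ℕP.+-comm v 1)

progression-∪ : ∀ {n a r len} (y : Fin n) → toℕ y ℕ.+ 1 ≡ a ℕ.+ len ℕ.* r →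
                progression n a r (suc len) ≡ progression n a r len ∪ ⁅ y ⁆
progression-∪ {n} {a} {r} {len} y y≡last = ∈-ext λ x →
  ⇔-trans (∈-progression a r (suc len) x)
  (⇔-trans (∃<suc⇔ len) (⇔-trans (⇔-sym (∈-progression a r len x) ⊎-⇔ is-last x) (⇔-sym ∪⇔⊎)))
  where
  is-last : ∀ x → (toℕ x ℕ.+ 1 ≡ a ℕ.+ len ℕ.* r) ⇔ x ∈ ⁅ y ⁆
  is-last x = mk⇔
    (λ x≡last → Equivalence.from x∈⁅y⁆⇔x≡y (FinP.toℕ-injective (ℕP.+-cancelʳ-≡ _ _ _ (trans x≡last (sym y≡last)))))
    (λ x∈⁅y⁆ → trans (cong (λ z → toℕ z ℕ.+ 1) (x∈⁅y⁆⇒x≡y y x∈⁅y⁆)) y≡last)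

last∉progression : ∀ {n a r len} (y : Fin n) → 1 ≤ r → toℕ y ℕ.+ 1 ≡ a ℕ.+ len ℕ.* r → y ∉ progression n a r len
last∉progression {a = a} {suc r} {len} y _ y≡last y∈ with Equivalence.to (∈-progression a (suc r) len y) y∈
... | i , i<len , y≡ith =
  ℕP.<⇒≢ i<len (ℕP.*-cancelʳ-≡ i len (suc r) (ℕP.+-cancelˡ-≡ a _ _ (trans (sym y≡ith) y≡last)))

∣progression∣ : ∀ {n a r} len → 1 ≤ r → InRange n a r len → ∣ progression n a r len ∣ ≡ len
∣progression∣ {n} {a} {r} zero _ _ =
  Empty⇒∣p∣≡0 {p = progression n a r 0} λ (x , x∈) →
    ℕP.n≮0 (proj₁ (proj₂ (Equivalence.to (∈-progression a r 0 x) x∈)))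
∣progression∣ {n} {a} {r} (suc len) 1≤r inRange = begin
  ∣ progression n a r (suc len) ∣        ≡⟨ cong ∣_∣ (progression-∪ {a = a} {r} {len} y y≡last) ⟩
  ∣ progression n a r len ∪ ⁅ y ⁆ ∣
    ≡⟨ x∉p⇒∣p∪⁅x⁆∣≡1+∣p∣ _ y (last∉progression {a = a} {r} {len} y 1≤r y≡last) ⟩
  suc ∣ progression n a r len ∣
    ≡⟨ cong suc (∣progression∣ len 1≤r λ i i<len → inRange i (ℕP.m<n⇒m<1+n i<len)) ⟩
  suc len                                ∎
  where
  open ≡-Reasoning
  last = toℕ+1-onto (a ℕ.+ len ℕ.* r) (proj₁ (inRange len ℕP.≤-refl)) (proj₂ (inRange len ℕP.≤-refl))
  y = proj₁ last
  y≡last = proj₂ last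

terms-shared : ∀ {n a r a′ r′ len} → InRange n a r len → progression n a r len ≡ progression n a′ r′ len →
               ∀ i → i < len → ∃ λ i′ → a ℕ.+ i ℕ.* r ≡ a′ ℕ.+ i′ ℕ.* r′
terms-shared {n} {a} {r} {a′} {r′} {len} inRange P≡P′ i i<len
  with toℕ+1-onto (a ℕ.+ i ℕ.* r) (proj₁ (inRange i i<len)) (proj₂ (inRange i i<len))
... | y , y≡ith with Equivalence.to (∈-progression a′ r′ len y)
                       (subst (y ∈_) P≡P′ (Equivalence.from (∈-progression a r len y) (i , i<len , y≡ith)))
... | i′ , _ , y≡i′th = i′ , trans (sym y≡ith) y≡i′th

first-≤ : ∀ {n a r a′ r′ len} → 1 ≤ len → InRange n a r len →
          progression n a r len ≡ progression n a′ r′ len → a′ ≤ a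
first-≤ {a = a} {r} {a′} {r′} 1≤len inRange P≡P′ with terms-shared inRange P≡P′ 0 1≤len
... | i′ , a+0≡ = subst (a′ ≤_) (trans (sym a+0≡) (ℕP.+-identityʳ a)) (ℕP.m≤m+n a′ (i′ ℕ.* r′))

step-≤ : ∀ {n a r r′ len} → 2 ≤ len → 1 ≤ r → InRange n a r len →
         progression n a r len ≡ progression n a r′ len → r′ ≤ r
step-≤ {a = a} {r} {r′} 2≤len 1≤r inRange P≡P′ with terms-shared inRange P≡P′ 1 2≤len
... | zero   , a+r≡ = ⊥-elim (ℕP.<⇒≢ 1≤r (sym (trans (sym (ℕP.+-identityʳ r)) (ℕP.+-cancelˡ-≡ a _ _ a+r≡))))
... | suc i′ , a+r≡ =
  subst (r′ ≤_) (trans (sym (ℕP.+-cancelˡ-≡ a _ _ a+r≡)) (ℕP.+-identityʳ r)) (ℕP.m≤m+n r′ (i′ ℕ.* r′))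

progression-injective : ∀ {n a r a′ r′ len} → 2 ≤ len → 1 ≤ r → 1 ≤ r′ →
                        InRange n a r len → InRange n a′ r′ len →
                        progression n a r len ≡ progression n a′ r′ len → a ≡ a′ × r ≡ r′
progression-injective {n} {a} {r} {a′} {r′} {len} 2≤len 1≤r 1≤r′ inRange inRange′ P≡P′ = a≡a′ , r≡r′
  where
  1≤len = ℕP.≤-trans (s≤s z≤n) 2≤len
  a≡a′ : a ≡ a′
  a≡a′ = ℕP.≤-antisym (first-≤ 1≤len inRange′ (sym P≡P′)) (first-≤ 1≤len inRange P≡P′)
  P≡P″ : progression n a r len ≡ progression n a r′ len
  P≡P″ = trans P≡P′ (cong (λ z → progression n z r′ len) (sym a≡a′))
  inRange″ : InRange n a r′ len
  inRange″ = subst (λ z → InRange n z r′ len) (sym a≡a′) inRange′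
  r≡r′ : r ≡ r′
  r≡r′ = ℕP.≤-antisym (step-≤ 2≤len 1≤r′ inRange″ (sym P≡P″)) (step-≤ 2≤len 1≤r inRange P≡P″)

-- Counting progressions

AP-≡ : ∀ {n k} {P Q : AP n k} → AP.set P ≡ AP.set Q → P ≡ Q
AP-≡ {P = ap S ∣S∣≡k isAP} {ap .S ∣S∣≡k′ _} refl = cong (λ e → ap S e isAP) (ℕP.≡-irrelevant ∣S∣≡k ∣S∣≡k′)

Fin1↔AP0 : ∀ n → Fin 1 ↔ AP n 0
Fin1↔AP0 n = mk↔ₛ′ (λ _ → ap ⊥ (∣⊥∣≡0 n) isAP-⊥) (λ _ → Fin.zero)
  (λ (ap S ∣S∣≡0 _) → AP-≡ (sym (∣p∣≡0⇒p≡⊥ S ∣S∣≡0))) λ { Fin.zero → refl ; (Fin.suc ()) }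
  where
  isAP-⊥ : IsAP (⊥ {n})
  isAP-⊥ = 1 , 1 , 0 , s≤s z≤n , (λ _ ()) , λ x → mk⇔ (⊥-elim ∘ ∉⊥) λ ()

Fin↔AP1 : ∀ n → Fin n ↔ AP n 1
Fin↔AP1 n = mk↔ₛ′ singleton (λ (ap S ∣S∣≡1 _) → proj₁ (∣p∣≡1⇒p≡⁅x⁆ S ∣S∣≡1))
  (λ (ap S ∣S∣≡1 _) → AP-≡ (sym (proj₂ (∣p∣≡1⇒p≡⁅x⁆ S ∣S∣≡1))))
  (λ y → sym (x∈⁅y⁆⇒x≡y _ (subst (y ∈_) (proj₂ (∣p∣≡1⇒p≡⁅x⁆ ⁅ y ⁆ (∣⁅x⁆∣≡1 y))) (x∈⁅x⁆ y))))
  where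
  isAP-⁅⁆ : ∀ y → IsAP ⁅ y ⁆
  isAP-⁅⁆ y = toℕ y ℕ.+ 1 , 1 , 1 , s≤s z≤n , inRange , mem
    where
    inRange : InRange n (toℕ y ℕ.+ 1) 1 1
    inRange = InRange-≤ (ℕP.m≤n+m 1 (toℕ y))
      (ℕP.≤-trans (ℕP.≤-reflexive (trans (ℕP.+-identityʳ _) (ℕP.+-comm (toℕ y) 1))) (FinP.toℕ<n y))
    mem : ∀ x → x ∈ ⁅ y ⁆ ⇔ (∃ λ i → i < 1 × toℕ x ℕ.+ 1 ≡ toℕ y ℕ.+ 1 ℕ.+ i ℕ.* 1)
    mem x = ⇔-trans x∈⁅y⁆⇔x≡y (mk⇔ (λ { refl → 0 , s≤s z≤n , sym (ℕP.+-identityʳ _) })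
      λ { (zero , _ , x≡y) → FinP.toℕ-injective (ℕP.+-cancelʳ-≡ _ _ _ (trans x≡y (ℕP.+-identityʳ _)))
        ; (suc _ , s≤s () , _) })
  singleton : Fin n → AP n 1
  singleton y = ap ⁅ y ⁆ (∣⁅x⁆∣≡1 y) (isAP-⁅⁆ y)

module _ (j n : ℕ) where

  -- a progression is placed by the number n - a of integers it spans and its first term x + 1 ≤ a + 1
  Placement : Set
  Placement = Σ (Fin (suc n)) λ a → Fin (positions (span? j (n ∸ toℕ a)) (toℕ a))

  start stride : Placement → ℕ
  start  (_ , x) = suc (toℕ x)
  stride (a , _) = step j (n ∸ toℕ a)

  toℕ≤n : (a : Fin (suc n)) → toℕ a ≤ n
  toℕ≤n a = s≤s⁻¹ (FinP.toℕ<n a)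

  placement-InRange : ∀ t → InRange n (start t) (stride t) (suc (suc j))
  placement-InRange (a , x) = InRange-≤ (s≤s z≤n) (begin
    suc (toℕ x) ℕ.+ suc j ℕ.* r   ≤⟨ ℕP.+-monoˡ-≤ (suc j ℕ.* r) (s≤s x≤a) ⟩
    suc (toℕ a) ℕ.+ suc j ℕ.* r   ≡⟨ ℕP.+-suc (toℕ a) (suc j ℕ.* r) ⟨
    toℕ a ℕ.+ suc (suc j ℕ.* r)   ≡⟨ cong (toℕ a ℕ.+_) (Span⇒≡ j span) ⟨
    toℕ a ℕ.+ (n ∸ toℕ a)         ≡⟨ ℕP.m+[n∸m]≡n (toℕ≤n a) ⟩
    n                             ∎)
    where
    open ℕP.≤-Reasoning
    r = step j (n ∸ toℕ a)
    span = proj₁ (positions-toℕ (span? j (n ∸ toℕ a)) x)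
    x≤a = proj₂ (positions-toℕ (span? j (n ∸ toℕ a)) x)

  toAP : Placement → AP n (suc (suc j))
  toAP t = ap (progression n (start t) (stride t) (suc (suc j)))
              (∣progression∣ (suc (suc j)) (s≤s z≤n) (placement-InRange t))
              (start t , stride t , suc (suc j) , s≤s z≤n , placement-InRange t ,
               ∈-progression (start t) (stride t) (suc (suc j)))

  toAP-injective : ∀ {t t′} → toAP t ≡ toAP t′ → t ≡ t′
  toAP-injective {a , x} {a′ , x′} toAP≡ = Σ-≡ a≡a′ (ℕP.suc-injective (proj₁ start≡×stride≡))
    where
    start≡×stride≡ : start (a , x) ≡ start (a′ , x′) × stride (a , x) ≡ stride (a′ , x′)
    start≡×stride≡ = progression-injective (s≤s (s≤s z≤n)) (s≤s z≤n) (s≤s z≤n)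
                       (placement-InRange (a , x)) (placement-InRange (a′ , x′)) (cong AP.set toAP≡)
    spans≡ : n ∸ toℕ a ≡ n ∸ toℕ a′
    spans≡ = step-injective j (proj₁ (positions-toℕ (span? j (n ∸ toℕ a)) x))
                              (proj₁ (positions-toℕ (span? j (n ∸ toℕ a′)) x′)) (proj₂ start≡×stride≡)
    a≡a′ : a ≡ a′
    a≡a′ = FinP.toℕ-injective (begin
      toℕ a                 ≡⟨ ℕP.m∸[m∸n]≡n (toℕ≤n a) ⟨
      n ∸ (n ∸ toℕ a)       ≡⟨ cong (n ∸_) spans≡ ⟩
      n ∸ (n ∸ toℕ a′)      ≡⟨ ℕP.m∸[m∸n]≡n (toℕ≤n a′) ⟩
      toℕ a′                ∎)
      where open ≡-Reasoning
    Σ-≡ : ∀ {a a′ : Fin (suc n)} {x x′} → a ≡ a′ → toℕ x ≡ toℕ x′ → _≡_ {A = Placement} (a , x) (a′ , x′)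
    Σ-≡ refl x≡x′ = cong (_ ,_) (FinP.toℕ-injective x≡x′)

  preimage : ∀ (S : Subset n) {a r} → IsAPWith S a r (suc (suc j)) → ∃ λ t → AP.set (toAP t) ≡ S
  preimage S {zero} (_ , inRange , _) with proj₁ (inRange 0 (s≤s z≤n))
  ... | ()
  preimage S {suc x₀} {zero} (() , _)
  preimage S {suc x₀} {suc q} isAPWith@(_ , inRange , _) = (a , x) , (begin
    progression n (suc (toℕ x)) (step j (n ∸ toℕ a)) (suc (suc j))
      ≡⟨ cong₂ (λ s r → progression n s r (suc (suc j))) (cong suc x≡x₀)
               (trans (cong (step j) n∸a≡m) (proj₂ (Span-of-step j q))) ⟩
    progression n (suc x₀) (suc q) (suc (suc j))
      ≡⟨ IsAPWith⇒≡progression isAPWith ⟨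
    S ∎)
    where
    open ≡-Reasoning
    m = suc (suc j ℕ.* suc q)
    last≤n : suc x₀ ℕ.+ suc j ℕ.* suc q ≤ n
    last≤n = proj₂ (inRange (suc j) ℕP.≤-refl)
    m≤n : m ≤ n
    m≤n = ℕP.≤-trans (s≤s (ℕP.m≤n+m _ x₀)) last≤n
    a : Fin (suc n)
    a = fromℕ< (s≤s (ℕP.m∸n≤m n m))
    toℕa≡n∸m : toℕ a ≡ n ∸ m
    toℕa≡n∸m = FinP.toℕ-fromℕ< (s≤s (ℕP.m∸n≤m n m))
    n∸a≡m : n ∸ toℕ a ≡ m
    n∸a≡m = trans (cong (n ∸_) toℕa≡n∸m) (ℕP.m∸[m∸n]≡n m≤n)
    x₀≤a : x₀ ≤ toℕ a
    x₀≤a = subst (x₀ ≤_) (sym toℕa≡n∸m)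
                 (ℕP.m+n≤o⇒m≤o∸n x₀ (subst (_≤ n) (sym (ℕP.+-suc x₀ _)) last≤n))
    placed : Σ (Fin (positions (span? j (n ∸ toℕ a)) (toℕ a))) λ x → toℕ x ≡ x₀
    placed = positions-fromℕ (span? j (n ∸ toℕ a)) (subst (Span j) (sym n∸a≡m) (proj₁ (Span-of-step j q))) x₀≤a
    x = proj₁ placed
    x≡x₀ = proj₂ placed

  preimage? : ∀ S → Dec (∃ λ t → AP.set (toAP t) ≡ S)
  preimage? S = map′ (λ (a , x , e) → (a , x) , e) (λ ((a , x) , e) → a , x , e)
    (FinP.any? λ a → FinP.any? λ x → VecP.≡-dec Bool._≟_ (AP.set (toAP (a , x))) S)

  toAP-surjective : ∀ P → ∃ λ t → ∀ {t′} → t′ ≡ t → toAP t′ ≡ P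
  toAP-surjective (ap S ∣S∣≡k isAP) = proj₁ t , λ { refl → AP-≡ (proj₂ t) }
    where
    preimage-of-AP : IsAP S → ∃ λ t → AP.set (toAP t) ≡ S
    preimage-of-AP (a , r , len , isAPWith@(1≤r , inRange , _)) =
      preimage S (subst (IsAPWith S a r) len≡k isAPWith)
      where
      len≡k : len ≡ suc (suc j)
      len≡k = begin
        len                                ≡⟨ ∣progression∣ len 1≤r inRange ⟨
        ∣ progression n a r len ∣          ≡⟨ cong ∣_∣ (IsAPWith⇒≡progression isAPWith) ⟨
        ∣ S ∣                              ≡⟨ ∣S∣≡k ⟩
        suc (suc j)                        ∎
        where open ≡-Reasoning
    -- isAP is irrelevant, so the placement is recovered by deciding whether one exists
    t = recompute (preimage? S) (preimage-of-AP isAP)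

  Fin-count↔AP : Fin (count j n) ↔ AP n (suc (suc j))
  Fin-count↔AP = ↔-trans (Fin-sumℕ↔Σ _ n) (⤖⇒↔ (mk⤖ {to = toAP} (toAP-injective , toAP-surjective)))

lemma2 : ∀ (n k : ℕ) → ∃ λ (c : ℕ) → (Fin c ↔ AP n k) × (+ c ≡ RHS n k)
lemma2 n zero          = 1 , Fin1↔AP0 n , sym (RHS-0 n)
lemma2 n (suc zero)    = n , Fin↔AP1 n , sym (RHS-1 n)
lemma2 n (suc (suc j)) = count j n , Fin-count↔AP j n , sym (RHS-2+ j n)
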